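{- Let $q=p^r$ with $p$ prime and $r\ge1$, let $n$ be a positive integer, and let $\ker(\mathrm{Tr})=\{x\in\mathbb{F}_{q^n}:\sum_{i=0}^{n-1}x^{q^i}=0\}$. Let $k$ be a positive integer with $\gcd(k,n)=1$, and assume $p\nmid n$ and $\gcd(n,p^{\gcd(k,r)}-1)=1$. Then for every $c\in\mathbb{F}_q$, the polynomial $x^{p^k}-cx$ permutes $\ker(\mathrm{Tr})$ (i.e., maps it bijectively onto itself). -}

module Defs where

open import Level using (Level; _⊔_)
open import Data.Nat as ℕ using (ℕ)
open import Data.Fin using (Fin; toℕ)
open import Data.Product using (Σ; ∃; _×_)
open import Relation.Nullary using (¬_)
open import Relation.Binary.PropositionalEquality as ≡ using (_≡_)
open import Function.Bundles using (Inverse)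
open import Algebra.Bundles using (CommutativeRing; Semiring)
import Algebra.Definitions.RawSemiring as RS
import Algebra.Definitions.RawMonoid as RM

module _ {c ℓ : Level} (F : CommutativeRing c ℓ) where
  open CommutativeRing F
  open RS (Semiring.rawSemiring semiring) using (_^_)
  open RM +-rawMonoid using (sum)

  record IsFiniteFieldOfSize (N : ℕ) : Set (c ⊔ ℓ) where
    field
      nontrivial : ¬ (1# ≈ 0#)
      inverse    : ∀ x → ¬ (x ≈ 0#) → ∃ λ y → x * y ≈ 1#
      card       : Inverse setoid (≡.setoid (Fin N))

  trace : (q n : ℕ) → Carrier → Carrier
  trace q n x = sum (λ (i : Fin n) → x ^ (q ℕ.^ toℕ i))

  InKer : (q n : ℕ) → Carrier → Set ℓ
  InKer q n x = trace q n x ≈ 0#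

  PermutesKer : (q n : ℕ) → (Carrier → Carrier) → Set (c ⊔ ℓ)
  PermutesKer q n f =
    (∀ x → InKer q n x → InKer q n (f x))
    × (∀ x y → InKer q n x → InKer q n y → f x ≈ f y → x ≈ y)
    × (∀ y → InKer q n y → ∃ λ x → InKer q n x × f x ≈ y)

  linPoly : (p k : ℕ) → Carrier → Carrier → Carrier
  linPoly p k a x = x ^ (p ℕ.^ k) - a * x

  InSubfield : (q : ℕ) → Carrier → Set ℓ
  InSubfield q a = a ^ q ≈ a

{-# OPTIONS --safe #-}

-- Write q = p^r and f x = x^(p^k) - a x.  As p = 0 in F, Frobenius is additive, hence so is f, and
-- f maps ker Tr to itself because Tr is F_q-linear and commutes with Frobenius; F being finite, it
-- remains to show that f has no nonzero root z in ker Tr.  For such z, w = z^(q-1) satisfies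
-- w^(p^k) = w (as a^(q-1) = 1) and w^(p^(rn)) = w (Fermat).  The exponents e with w^(p^e) = w are
-- closed under sums and differences, so they contain gcd(k, rn), a divisor of gcd(k, r) since
-- gcd(k, n) = 1; thus w^q = w.  Then z^(q^i) = z w^i, so w^n = 1, and w^(p^gcd(k,r) - 1) = 1,
-- whence w = 1 by the last coprimality hypothesis.  So 0 = Tr z = n z, impossible as p ∤ n.
module Submission where

open import Defs
open import Level using (Level)
open import Data.Nat as ℕ using (ℕ; zero; suc; z≤n; s≤s)
import Data.Nat.Properties as ℕ
open import Data.Nat.Combinatorics using (_C_; nCn≡1)
open import Data.Nat.Divisibility using (_∣_; divides; 1∣_)
open import Data.Nat.GCD using (gcd; gcd[m,n]∣n)
open import Data.Nat.Primality using (Prime; prime⇒nonZero)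
open import Data.Fin as Fin using (Fin; toℕ; punchIn; punchOut)
import Data.Fin.Properties as Fin
open import Data.Fin.Permutation using (Permutation; permutation)
open import Data.Product as Product using (∃; _,_; proj₁; proj₂)
open import Function.Base using (_∘_)
open import Function.Bundles using (Inverse; Injection)
open import Function.Properties.Inverse using (Inverse⇒Injection)
open import Function.Definitions using (Injective)
open import Relation.Nullary using (¬_; Dec; yes; no; contradiction)
open import Relation.Binary.Bundles using (Setoid)
open import Relation.Binary.PropositionalEquality as ≡ using (_≡_; _≢_)
open import Algebra.Bundles using (Monoid; CommutativeMonoid; CommutativeRing)

module Arithmetic where
  open import Data.Nat
  open import Data.Nat.Properties
  open import Data.Nat.Combinatorics
  open import Data.Nat.Divisibility
  open import Data.Nat.GCD
  open import Data.Nat.Primality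
  open import Data.Nat.Coprimality using (Coprime; coprime-divisor)
  open import Data.Sum using (inj₁; inj₂)
  open import Relation.Binary.PropositionalEquality
  open ≡-Reasoning

  [k+1]*[n+1]C[k+1]≡[n+1]*nCk : ∀ n k → suc k * (suc n C suc k) ≡ suc n * (n C k)
  [k+1]*[n+1]C[k+1]≡[n+1]*nCk zero    zero    = refl
  [k+1]*[n+1]C[k+1]≡[n+1]*nCk zero    (suc k) = begin
    suc (suc k) * (1 C suc (suc k)) ≡⟨ cong (suc (suc k) *_) (k>n⇒nCk≡0 {1} {suc (suc k)} (s≤s (s≤s z≤n))) ⟩
    suc (suc k) * 0                 ≡⟨ *-zeroʳ (suc (suc k)) ⟩
    0                               ≡⟨ cong (1 *_) (k>n⇒nCk≡0 {0} {suc k} (s≤s z≤n)) ⟨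
    1 * (0 C suc k)                 ∎
  [k+1]*[n+1]C[k+1]≡[n+1]*nCk (suc n) zero    = begin
    1 * (suc (suc n) C 1) ≡⟨ *-identityˡ _ ⟩
    suc (suc n) C 1       ≡⟨ nC1≡n (suc (suc n)) ⟩
    suc (suc n)           ≡⟨ *-identityʳ (suc (suc n)) ⟨
    suc (suc n) * 1       ∎
  [k+1]*[n+1]C[k+1]≡[n+1]*nCk (suc n) (suc k) = begin
    suc (suc k) * (suc (suc n) C suc (suc k))
      ≡⟨ cong (suc (suc k) *_) (nCk+nC[k+1]≡[n+1]C[k+1] (suc n) (suc k)) ⟨
    suc (suc k) * (a + b)
      ≡⟨ *-distribˡ-+ (suc (suc k)) a b ⟩
    a + suc k * a + suc (suc k) * b
      ≡⟨ cong₂ (λ u v → a + u + v) ([k+1]*[n+1]C[k+1]≡[n+1]*nCk n k)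
                                   ([k+1]*[n+1]C[k+1]≡[n+1]*nCk n (suc k)) ⟩
    a + suc n * (n C k) + suc n * (n C suc k)
      ≡⟨ +-assoc a _ _ ⟩
    a + (suc n * (n C k) + suc n * (n C suc k))
      ≡⟨ cong (a +_) (*-distribˡ-+ (suc n) (n C k) (n C suc k)) ⟨
    a + suc n * (n C k + n C suc k)
      ≡⟨ cong (λ u → a + suc n * u) (nCk+nC[k+1]≡[n+1]C[k+1] n k) ⟩
    suc (suc n) * a ∎
    where
    a = suc n C suc k
    b = suc n C suc (suc k)

  prime∣pCk : ∀ {p k} → Prime p → 0 < k → k < p → p ∣ p C k
  prime∣pCk {suc p} {suc k} p-prime _ k<p
    with euclidsLemma (suc k) (suc p C suc k) p-prime
           (divides (p C k) (trans ([k+1]*[n+1]C[k+1]≡[n+1]*nCk p k) (*-comm (suc p) (p C k))))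
  ... | inj₁ p∣k+1 = contradiction (∣⇒≤ p∣k+1) (<⇒≱ k<p)
  ... | inj₂ p∣pCk = p∣pCk

  prime∤⇒gcd≡1 : ∀ {p n} → Prime p → ¬ p ∣ n → gcd n p ≡ 1
  prime∤⇒gcd≡1 {p} {n} p-prime p∤n with prime⇒irreducible p-prime (gcd[m,n]∣n n p)
  ... | inj₁ gcd≡1 = gcd≡1
  ... | inj₂ gcd≡p = contradiction (subst (_∣ n) gcd≡p (gcd[m,n]∣m n p)) p∤n

  record IsAdditiveIdeal {ℓ} (Q : ℕ → Set ℓ) : Set ℓ where
    field
      0∈       : Q 0
      +-closed : ∀ {m n} → Q m → Q n → Q (m + n)
      ∸-closed : ∀ {m n} → Q (m + n) → Q n → Q m

    *-closed : ∀ k {m} → Q m → Q (k * m)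
    *-closed zero    _  = 0∈
    *-closed (suc k) qm = +-closed qm (*-closed k qm)

    ∣-closed : ∀ {m n} → m ∣ n → Q m → Q n
    ∣-closed (divides k refl) = *-closed k

    gcd-closed : ∀ {m n} → Q m → Q n → Q (gcd m n)
    gcd-closed {m} {n} qm qn with Bézout.lemma m n
    ... | Bézout.result d isGCD (Bézout.+- x y d+yn≡xm) =
      subst Q (GCD.unique isGCD (gcd-GCD m n))
        (∸-closed (subst Q (sym d+yn≡xm) (*-closed x qm)) (*-closed y qn))
    ... | Bézout.result d isGCD (Bézout.-+ x y d+xm≡yn) =
      subst Q (GCD.unique isGCD (gcd-GCD m n))
        (∸-closed (subst Q (sym d+xm≡yn) (*-closed y qn)) (*-closed x qm))

    coprime-closed : ∀ m n → gcd m n ≡ 1 → Q m → Q n → Q 1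
    coprime-closed m n gcd≡1 qm qn = subst Q gcd≡1 (gcd-closed qm qn)

    -- gcd k (r * n) divides gcd k r because it is coprime to n.
    gcd-closed-coprime : ∀ k r n → gcd k n ≡ 1 → Q k → Q (r * n) → Q (gcd k r)
    gcd-closed-coprime k r n gcd[k,n]≡1 qk qrn = ∣-closed g∣gcd[k,r] (gcd-closed qk qrn)
      where
      g = gcd k (r * n)
      g-coprime-n : Coprime g n
      g-coprime-n (d∣g , d∣n) = ∣1⇒≡1 (subst (_ ∣_) gcd[k,n]≡1
        (gcd-greatest (∣-trans d∣g (gcd[m,n]∣m k (r * n))) d∣n))
      g∣gcd[k,r] : g ∣ gcd k r
      g∣gcd[k,r] = gcd-greatest (gcd[m,n]∣m k (r * n))
        (coprime-divisor g-coprime-n (subst (g ∣_) (*-comm r n) (gcd[m,n]∣n k (r * n))))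

open Arithmetic

injective⇒surjective : ∀ {n} (g : Fin n → Fin n) → Injective _≡_ _≡_ g → ∀ y → ∃ λ i → g i ≡ y
injective⇒surjective {suc n} g g-injective y with Fin.any? (λ i → g i Fin.≟ y)
... | yes y∈image = y∈image
... | no  y∉image = contradiction (Fin.injective⇒≤ h-injective) ℕ.1+n≰n
  where
  g≢y : ∀ i → g i ≢ y
  g≢y i gi≡y = y∉image (i , gi≡y)
  h : Fin (suc n) → Fin n
  h i = punchOut (g≢y i ∘ ≡.sym)
  h-injective : Injective _≡_ _≡_ h
  h-injective {i} {j} = g-injective ∘ Fin.punchOut-injective (g≢y i ∘ ≡.sym) (g≢y j ∘ ≡.sym)

module FiniteMonoidSum {c ℓ : Level} (M : CommutativeMonoid c ℓ) where
  open CommutativeMonoid M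
  open import Algebra.Properties.CommutativeMonoid.Sum M using (sum; sum-remove; sum-cong-≋; sum-replicate)
  open import Algebra.Properties.Monoid.Mult monoid using (_×_)

  sum-except : ∀ {n} (t : Fin n → Carrier) {a} i → t i ≈ ε → (∀ j → j ≢ i → t j ≈ a) →
               sum t ≈ ℕ.pred n × a
  sum-except {suc n} t {a} i tᵢ≈ε tⱼ≈a = begin
    sum t                                    ≈⟨ sum-remove t ⟩
    t i ∙ sum (λ j → t (punchIn i j))        ≈⟨ ∙-cong tᵢ≈ε (sum-cong-≋ λ j → tⱼ≈a _ (Fin.punchInᵢ≢i i j)) ⟩
    ε ∙ sum {n} (λ _ → a)                    ≈⟨ identityˡ _ ⟩
    sum {n} (λ _ → a)                        ≈⟨ sum-replicate n ⟩
    n × a                                    ∎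
    where open import Relation.Binary.Reasoning.Setoid setoid

module Enumeration {a ℓa : Level} (S : Setoid a ℓa) {N : ℕ} (card : Inverse S (≡.setoid (Fin N)))
                   {m ℓm : Level} (M : CommutativeMonoid m ℓm) where
  open Setoid S using (_≈_; _≉_) renaming (Carrier to E)
  open CommutativeMonoid M using (Carrier; ε; trans) renaming (_≈_ to _≈ᴹ_)
  open import Algebra.Properties.CommutativeMonoid.Sum M using (sum; sum-permute; sum-cong-≋)
  open import Algebra.Properties.Monoid.Mult (CommutativeMonoid.monoid M) using (_×_)
  open FiniteMonoidSum M using (sum-except)
  module Card = Inverse card

  fold : (E → Carrier) → Carrier
  fold f = sum (f ∘ Card.from)

  module _ {f : E → Carrier} (f-cong : ∀ {x y} → x ≈ y → f x ≈ᴹ f y) where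

    fold-reindex : ∀ {φ ψ} → (∀ {x y} → x ≈ y → φ x ≈ φ y) → (∀ {x y} → x ≈ y → ψ x ≈ ψ y) →
                   (∀ x → φ (ψ x) ≈ x) → (∀ x → ψ (φ x) ≈ x) → fold f ≈ᴹ fold (f ∘ φ)
    fold-reindex {φ} {ψ} φ-cong ψ-cong φψ≈id ψφ≈id =
      trans (sum-permute (f ∘ Card.from) π) (sum-cong-≋ {N} (λ i → f-cong (Card.strictlyInverseʳ _)))
      where
      π : Permutation N N
      π = permutation (Card.to ∘ φ ∘ Card.from) (Card.to ∘ ψ ∘ Card.from)
            (λ i → ≡.trans (Card.to-cong (Setoid.trans S (φ-cong (Card.strictlyInverseʳ _)) (φψ≈id _)))
                           (Card.strictlyInverseˡ i))
            (λ i → ≡.trans (Card.to-cong (Setoid.trans S (ψ-cong (Card.strictlyInverseʳ _)) (ψφ≈id _)))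
                           (Card.strictlyInverseˡ i))

    fold-except : ∀ {a} y → f y ≈ᴹ ε → (∀ x → x ≉ y → f x ≈ᴹ a) → fold f ≈ᴹ ℕ.pred N × a
    fold-except y fy≈ε fx≈a = sum-except (f ∘ Card.from) (Card.to y)
      (trans (f-cong (Card.strictlyInverseʳ y)) fy≈ε)
      (λ j j≢to-y → fx≈a _ λ from-j≈y →
        j≢to-y (≡.trans (≡.sym (Card.strictlyInverseˡ j)) (Card.to-cong from-j≈y)))

module Exponents {c ℓ : Level} (M : Monoid c ℓ) where
  open Monoid M
  open import Algebra.Properties.Monoid.Mult M using (_×_; ×-homo-+)

  annihilator-ideal : ∀ x → IsAdditiveIdeal (λ e → e × x ≈ ε)
  annihilator-ideal x = record
    { 0∈       = refl
    ; +-closed = λ {m} {n} mx≈ε nx≈ε → trans (×-homo-+ x m n) (trans (∙-cong mx≈ε nx≈ε) (identityˡ ε))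
    ; ∸-closed = λ {m} {n} [m+n]x≈ε nx≈ε → begin
        m × x           ≈⟨ sym (identityʳ (m × x)) ⟩
        m × x ∙ ε       ≈⟨ ∙-congˡ nx≈ε ⟨
        m × x ∙ n × x   ≈⟨ ×-homo-+ x m n ⟨
        (m ℕ.+ n) × x   ≈⟨ [m+n]x≈ε ⟩
        ε               ∎
    }
    where open import Relation.Binary.Reasoning.Setoid setoid

module CharacteristicP {c ℓ : Level} (R : CommutativeRing c ℓ) where
  open CommutativeRing R
  open import Algebra.Properties.CommutativeSemiring.Exp commutativeSemiring
    using (_^_; ^-congˡ; ^-congʳ; ^-assocʳ; ^-distrib-*)
  open import Algebra.Properties.Semiring.Mult semiring
    using (_×_; ×-homo-1; ×-assocˡ; ×-assoc-*; ×-congʳ)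
  open import Algebra.Properties.CommutativeMonoid.Sum +-commutativeMonoid
    using (sum; sum-cong-≋; sum-init-last; sum-replicate-zero; ∑-distrib-+)
  open import Algebra.Properties.Semiring.Sum semiring using (*-distribˡ-sum)
  open import Algebra.Properties.CommutativeSemiring.Binomial commutativeSemiring
    using (theorem; binomialTerm)
  open import Algebra.Properties.Group +-group using (//-rightDividesˡ)
  open import Algebra.Properties.AbelianGroup +-abelianGroup using (⁻¹-∙-comm)
  open import Algebra.Properties.CommutativeSemigroup +-commutativeSemigroup using (interchange)
  open import Relation.Binary.Reasoning.Setoid setoid

  ^-comm-^ : ∀ x m n → (x ^ m) ^ n ≈ (x ^ n) ^ m
  ^-comm-^ x m n = trans (^-assocʳ x m n) (trans (^-congʳ x (ℕ.*-comm m n)) (sym (^-assocʳ x n m)))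

  frobenius-fixed-ideal : ∀ p x → IsAdditiveIdeal (λ e → x ^ (p ℕ.^ e) ≈ x)
  frobenius-fixed-ideal p x = record
    { 0∈       = *-identityʳ x
    ; +-closed = λ {m} {n} fm fn → trans (^-p^[m+n] m n) (trans (^-congˡ (p ℕ.^ n) fm) fn)
    ; ∸-closed = λ {m} {n} fmn fn → begin
        x ^ (p ℕ.^ m)                  ≈⟨ ^-congˡ (p ℕ.^ m) fn ⟨
        (x ^ (p ℕ.^ n)) ^ (p ℕ.^ m)    ≈⟨ ^-comm-^ x (p ℕ.^ n) (p ℕ.^ m) ⟩
        (x ^ (p ℕ.^ m)) ^ (p ℕ.^ n)    ≈⟨ ^-p^[m+n] m n ⟨
        x ^ (p ℕ.^ (m ℕ.+ n))          ≈⟨ fmn ⟩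
        x                              ∎
    }
    where
    ^-p^[m+n] : ∀ m n → x ^ (p ℕ.^ (m ℕ.+ n)) ≈ (x ^ (p ℕ.^ m)) ^ (p ℕ.^ n)
    ^-p^[m+n] m n = trans (^-congʳ x (ℕ.^-distribˡ-+-* p m n)) (sym (^-assocʳ x (p ℕ.^ m) (p ℕ.^ n)))

  ×0≈0 : ∀ m → m × 0# ≈ 0#
  ×0≈0 zero    = refl
  ×0≈0 (suc m) = trans (+-identityˡ _) (×0≈0 m)

  freshman's-dream : ∀ {p} → 0 ℕ.< p → (∀ {k} → 0 ℕ.< k → k ℕ.< p → ∀ z → (p C k) × z ≈ 0#) →
                     ∀ x y → (x + y) ^ p ≈ x ^ p + y ^ p
  freshman's-dream {suc p′} _ pCk×≈0 x y = begin
    (x + y) ^ p                                  ≈⟨ theorem p x y ⟩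
    t Fin.zero + sum (λ i → t (Fin.suc i))       ≈⟨ +-congˡ (sum-init-last (λ i → t (Fin.suc i))) ⟩
    t Fin.zero + (sum middle + t (Fin.fromℕ p))  ≈⟨ +-congˡ (+-congʳ sum-middle≈0) ⟩
    t Fin.zero + (0# + t (Fin.fromℕ p))          ≈⟨ +-cong first≈y^p (trans (+-identityˡ _) last≈x^p) ⟩
    y ^ p + x ^ p                                ≈⟨ +-comm _ _ ⟩
    x ^ p + y ^ p                                ∎
    where
    p = suc p′
    t = binomialTerm x y p
    middle : Fin p′ → Carrier
    middle i = t (Fin.suc (Fin.inject₁ i))
    t≡ : ∀ i {k} → toℕ i ≡ k → t i ≈ (p C k) × (x ^ k * y ^ (p ℕ.∸ k))
    t≡ i ≡.refl = refl
    sum-middle≈0 : sum middle ≈ 0#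
    sum-middle≈0 = trans (sum-cong-≋ middle≈0) (sum-replicate-zero p′)
      where
      middle≈0 : ∀ i → middle i ≈ 0#
      middle≈0 i = trans (t≡ (Fin.suc (Fin.inject₁ i)) (≡.cong suc (Fin.toℕ-inject₁ i)))
                         (pCk×≈0 (s≤s z≤n) (s≤s (Fin.toℕ<n i)) _)
    first≈y^p : t Fin.zero ≈ y ^ p
    first≈y^p = trans (×-homo-1 _) (*-identityˡ _)
    last≈x^p : t (Fin.fromℕ p) ≈ x ^ p
    last≈x^p = begin
      t (Fin.fromℕ p)                        ≈⟨ t≡ (Fin.fromℕ p) (Fin.toℕ-fromℕ p) ⟩
      (p C p) × (x ^ p * y ^ (p ℕ.∸ p))      ≡⟨ ≡.cong (_× (x ^ p * y ^ (p ℕ.∸ p))) (nCn≡1 p) ⟩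
      1 × (x ^ p * y ^ (p ℕ.∸ p))            ≈⟨ ×-homo-1 _ ⟩
      x ^ p * y ^ (p ℕ.∸ p)                  ≈⟨ *-congˡ (^-congʳ y (ℕ.n∸n≡0 p)) ⟩
      x ^ p * 1#                             ≈⟨ *-identityʳ _ ⟩
      x ^ p                                  ∎

  module Frobenius {p : ℕ} (p-prime : Prime p) (p×1≈0 : p × 1# ≈ 0#) where

    instance
      p-nonZero : ℕ.NonZero p
      p-nonZero = prime⇒nonZero p-prime

    p×≈0 : ∀ x → p × x ≈ 0#
    p×≈0 x = begin
      p × x         ≈⟨ ×-congʳ p (*-identityˡ x) ⟨
      p × (1# * x)  ≈⟨ ×-assoc-* p 1# x ⟨
      (p × 1#) * x  ≈⟨ *-congʳ p×1≈0 ⟩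
      0# * x        ≈⟨ zeroˡ x ⟩
      0#            ∎

    pCk×≈0 : ∀ {k} → 0 ℕ.< k → k ℕ.< p → ∀ x → (p C k) × x ≈ 0#
    pCk×≈0 {k} 0<k k<p x with prime∣pCk p-prime 0<k k<p
    ... | divides m pCk≡m*p = begin
      (p C k) × x        ≡⟨ ≡.cong (_× x) pCk≡m*p ⟩
      (m ℕ.* p) × x      ≈⟨ ×-assocˡ x m p ⟨
      m × (p × x)        ≈⟨ ×-congʳ m (p×≈0 x) ⟩
      m × 0#             ≈⟨ ×0≈0 m ⟩
      0#                 ∎

    ^p-homo-+ : ∀ x y → (x + y) ^ p ≈ x ^ p + y ^ p
    ^p-homo-+ = freshman's-dream (ℕ.>-nonZero⁻¹ p) pCk×≈0

    ^p^e-homo-+ : ∀ e x y → (x + y) ^ (p ℕ.^ e) ≈ x ^ (p ℕ.^ e) + y ^ (p ℕ.^ e)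
    ^p^e-homo-+ zero    x y = trans (*-identityʳ _) (sym (+-cong (*-identityʳ x) (*-identityʳ y)))
    ^p^e-homo-+ (suc e) x y = begin
      (x + y) ^ (p ℕ.* p ℕ.^ e)                  ≈⟨ ^-assocʳ (x + y) p (p ℕ.^ e) ⟨
      ((x + y) ^ p) ^ (p ℕ.^ e)                  ≈⟨ ^-congˡ (p ℕ.^ e) (^p-homo-+ x y) ⟩
      (x ^ p + y ^ p) ^ (p ℕ.^ e)                ≈⟨ ^p^e-homo-+ e (x ^ p) (y ^ p) ⟩
      (x ^ p) ^ (p ℕ.^ e) + (y ^ p) ^ (p ℕ.^ e)  ≈⟨ +-cong (^-assocʳ x p (p ℕ.^ e)) (^-assocʳ y p (p ℕ.^ e)) ⟩
      x ^ (p ℕ.* p ℕ.^ e) + y ^ (p ℕ.* p ℕ.^ e)  ∎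

    0^p^e≈0 : ∀ e → 0# ^ (p ℕ.^ e) ≈ 0#
    0^p^e≈0 e = trans (^-congʳ 0# (≡.sym (ℕ.suc-pred (p ℕ.^ e) {{ℕ.m^n≢0 p e}}))) (zeroˡ _)

    ^p^e-homo-sum : ∀ e {m} (t : Fin m → Carrier) → sum t ^ (p ℕ.^ e) ≈ sum (λ i → t i ^ (p ℕ.^ e))
    ^p^e-homo-sum e {zero}  t = 0^p^e≈0 e
    ^p^e-homo-sum e {suc m} t = trans (^p^e-homo-+ e _ _) (+-congˡ (^p^e-homo-sum e (λ i → t (Fin.suc i))))

    module Trace (r n : ℕ) where
      q : ℕ
      q = p ℕ.^ r

      Tr : Carrier → Carrier
      Tr = trace R q n

      Ker : Carrier → Set ℓ
      Ker = InKer R q n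

      ^q^i-homo-+ : ∀ i x y → (x + y) ^ (q ℕ.^ i) ≈ x ^ (q ℕ.^ i) + y ^ (q ℕ.^ i)
      ^q^i-homo-+ i rewrite ℕ.^-*-assoc p r i = ^p^e-homo-+ (r ℕ.* i)

      ^q^i-fixed : ∀ {a} → a ^ q ≈ a → ∀ i → a ^ (q ℕ.^ i) ≈ a
      ^q^i-fixed {a} _     zero    = *-identityʳ a
      ^q^i-fixed {a} a^q≈a (suc i) = begin
        a ^ (q ℕ.* q ℕ.^ i)   ≈⟨ ^-assocʳ a q (q ℕ.^ i) ⟨
        (a ^ q) ^ (q ℕ.^ i)   ≈⟨ ^-congˡ (q ℕ.^ i) a^q≈a ⟩
        a ^ (q ℕ.^ i)         ≈⟨ ^q^i-fixed a^q≈a i ⟩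
        a                     ∎

      trace-cong : ∀ {x y} → x ≈ y → Tr x ≈ Tr y
      trace-cong x≈y = sum-cong-≋ {n} (λ i → ^-congˡ (q ℕ.^ toℕ i) x≈y)

      trace-homo-+ : ∀ x y → Tr (x + y) ≈ Tr x + Tr y
      trace-homo-+ x y = trans (sum-cong-≋ {n} (λ i → ^q^i-homo-+ (toℕ i) x y)) (∑-distrib-+ {n} _ _)

      trace-^p^k : ∀ k x → Tr (x ^ (p ℕ.^ k)) ≈ Tr x ^ (p ℕ.^ k)
      trace-^p^k k x = begin
        Tr (x ^ P)                               ≈⟨ sum-cong-≋ {n} (λ i → ^-comm-^ x P (q ℕ.^ toℕ i)) ⟩
        sum {n} (λ i → (x ^ (q ℕ.^ toℕ i)) ^ P)  ≈⟨ ^p^e-homo-sum k {n} _ ⟨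
        Tr x ^ P                                 ∎
        where P = p ℕ.^ k

      trace-scalar : ∀ {a} → a ^ q ≈ a → ∀ x → Tr (a * x) ≈ a * Tr x
      trace-scalar {a} a^q≈a x = begin
        Tr (a * x)                             ≈⟨ sum-cong-≋ {n} (λ i → a*x^qⁱ (toℕ i)) ⟩
        sum {n} (λ i → a * x ^ (q ℕ.^ toℕ i))  ≈⟨ *-distribˡ-sum {n} a _ ⟨
        a * Tr x                               ∎
        where
        a*x^qⁱ : ∀ i → (a * x) ^ (q ℕ.^ i) ≈ a * x ^ (q ℕ.^ i)
        a*x^qⁱ i = trans (^-distrib-* a x (q ℕ.^ i)) (*-congʳ (^q^i-fixed a^q≈a i))

      ker-sub : ∀ {x y} → Ker x → Ker y → Ker (x - y)
      ker-sub {x} {y} Trx≈0 Try≈0 = begin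
        Tr (x - y)            ≈⟨ +-identityʳ _ ⟨
        Tr (x - y) + 0#       ≈⟨ +-congˡ Try≈0 ⟨
        Tr (x - y) + Tr y     ≈⟨ trace-homo-+ (x - y) y ⟨
        Tr (x - y + y)        ≈⟨ trace-cong (//-rightDividesˡ y x) ⟩
        Tr x                  ≈⟨ Trx≈0 ⟩
        0#                    ∎

      module Linearized (k : ℕ) {a : Carrier} (a^q≈a : a ^ q ≈ a) where
        f : Carrier → Carrier
        f = linPoly R p k a

        f-cong : ∀ {x y} → x ≈ y → f x ≈ f y
        f-cong x≈y = +-cong (^-congˡ (p ℕ.^ k) x≈y) (-‿cong (*-congˡ x≈y))

        f-homo-+ : ∀ x y → f (x + y) ≈ f x + f y
        f-homo-+ x y = begin
          (x + y) ^ P - a * (x + y)                  ≈⟨ +-cong (^p^e-homo-+ k x y) (-‿cong (distribˡ a x y)) ⟩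
          (x ^ P + y ^ P) - (a * x + a * y)          ≈⟨ +-congˡ (⁻¹-∙-comm (a * x) (a * y)) ⟨
          (x ^ P + y ^ P) + (- (a * x) + - (a * y))  ≈⟨ interchange _ _ _ _ ⟩
          f x + f y                                  ∎
          where P = p ℕ.^ k

        f-ker : ∀ x → Ker x → Ker (f x)
        f-ker x Trx≈0 = ker-sub (trans (trace-^p^k k x) (trans (^-congˡ (p ℕ.^ k) Trx≈0) (0^p^e≈0 k)))
                              (trans (trace-scalar a^q≈a x) (trans (*-congˡ Trx≈0) (zeroʳ a)))

module FiniteField {c ℓ : Level} (F : CommutativeRing c ℓ) {N : ℕ} (isFF : IsFiniteFieldOfSize F N) where
  open CommutativeRing F
  open IsFiniteFieldOfSize isFF
  open import Algebra.Properties.CommutativeSemiring.Exp commutativeSemiring using (_^_; ^-congʳ)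
  open import Algebra.Properties.Semiring.Mult semiring using (_×_; ×-homo-1; ×1-homo-*)
  open import Algebra.Properties.Group +-group using (∙-cancelˡ; //-rightDividesˡ; //-rightDividesʳ)
  open import Relation.Binary.Reasoning.Setoid setoid
  module Card = Inverse card
  open import Algebra.Properties.CommutativeMonoid.Sum +-commutativeMonoid
    using (sum-cong-≋; ∑-distrib-+; sum-replicate)
  open import Algebra.Properties.CommutativeMonoid.Sum *-commutativeMonoid
    using () renaming (sum to prod; sum-cong-≋ to prod-cong-≋; ∑-distrib-+ to prod-distrib-*)

  instance
    N-nonZero : ℕ.NonZero N
    N-nonZero = Fin.nonZeroIndex (Card.to 0#)

  to-injective : ∀ {x y} → Card.to x ≡ Card.to y → x ≈ y
  to-injective = Injection.injective (Inverse⇒Injection card)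

  infix 4 _≈?_
  _≈?_ : ∀ x y → Dec (x ≈ y)
  x ≈? y with Card.to x Fin.≟ Card.to y
  ... | yes to-x≡to-y = yes (to-injective to-x≡to-y)
  ... | no  to-x≢to-y = no (to-x≢to-y ∘ Card.to-cong)

  module Invertible {x : Carrier} (x≉0 : x ≉ 0#) where
    x⁻¹ : Carrier
    x⁻¹ = proj₁ (inverse x x≉0)

    x⁻¹*x≈1 : x⁻¹ * x ≈ 1#
    x⁻¹*x≈1 = trans (*-comm x⁻¹ x) (proj₂ (inverse x x≉0))

    x⁻¹*[x*u]≈u : ∀ u → x⁻¹ * (x * u) ≈ u
    x⁻¹*[x*u]≈u u = trans (sym (*-assoc x⁻¹ x u)) (trans (*-congʳ x⁻¹*x≈1) (*-identityˡ u))

    x*[x⁻¹*u]≈u : ∀ u → x * (x⁻¹ * u) ≈ u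
    x*[x⁻¹*u]≈u u = trans (sym (*-assoc x x⁻¹ u)) (trans (*-congʳ (proj₂ (inverse x x≉0))) (*-identityˡ u))

  *-cancelˡ : ∀ {x y z} → x ≉ 0# → x * y ≈ x * z → y ≈ z
  *-cancelˡ {x} {y} {z} x≉0 xy≈xz = trans (sym (x⁻¹*[x*u]≈u y)) (trans (*-congˡ xy≈xz) (x⁻¹*[x*u]≈u z))
    where open Invertible x≉0

  *-≉0 : ∀ {x y} → x ≉ 0# → y ≉ 0# → x * y ≉ 0#
  *-≉0 {x} x≉0 y≉0 xy≈0 = y≉0 (*-cancelˡ x≉0 (trans xy≈0 (sym (zeroʳ x))))

  ^-≉0 : ∀ {x} n → x ≉ 0# → x ^ n ≉ 0#
  ^-≉0 zero    _   = nontrivial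
  ^-≉0 (suc n) x≉0 = *-≉0 x≉0 (^-≉0 n x≉0)

  ^≈0⇒≈0 : ∀ {x} n → x ^ n ≈ 0# → x ≈ 0#
  ^≈0⇒≈0 {x} n xⁿ≈0 with x ≈? 0#
  ... | yes x≈0 = x≈0
  ... | no  x≉0 = contradiction xⁿ≈0 (^-≉0 n x≉0)

  prod-≉0 : ∀ {n} (t : Fin n → Carrier) → (∀ i → t i ≉ 0#) → prod t ≉ 0#
  prod-≉0 {zero}  t _      = nontrivial
  prod-≉0 {suc n} t t≉0 = *-≉0 (t≉0 Fin.zero) (prod-≉0 (t ∘ Fin.suc) (t≉0 ∘ Fin.suc))

  open Enumeration setoid card +-commutativeMonoid using () renaming (fold to ∑; fold-reindex to ∑-reindex)
  open Enumeration setoid card *-commutativeMonoid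
    using () renaming (fold to ∏; fold-reindex to ∏-reindex; fold-except to ∏-except)

  N×≈0 : ∀ x → N × x ≈ 0#
  N×≈0 x = ∙-cancelˡ S (N × x) 0# (begin
    S + N × x                ≈⟨ +-congˡ (sum-replicate N) ⟨
    S + ∑ (λ _ → x)          ≈⟨ ∑-distrib-+ {N} _ _ ⟨
    ∑ (_+ x)                 ≈⟨ ∑-reindex (λ y≈z → y≈z) +-congʳ +-congʳ (//-rightDividesˡ x) (//-rightDividesʳ x) ⟨
    S                        ≈⟨ +-identityʳ S ⟨
    S + 0#                   ∎)
    where S = ∑ (λ y → y)

  characteristic : ∀ {p e} → N ≡ p ℕ.^ e → p × 1# ≈ 0#
  characteristic {p} {e} N≡pᵉ =
    ^≈0⇒≈0 e (trans (sym (pᵉ×1≈[p×1]ᵉ e)) (≡.subst (λ m → m × 1# ≈ 0#) N≡pᵉ (N×≈0 1#)))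
    where
    pᵉ×1≈[p×1]ᵉ : ∀ e → (p ℕ.^ e) × 1# ≈ (p × 1#) ^ e
    pᵉ×1≈[p×1]ᵉ zero    = ×-homo-1 1#
    pᵉ×1≈[p×1]ᵉ (suc e) = trans (×1-homo-* p (p ℕ.^ e)) (*-congˡ (pᵉ×1≈[p×1]ᵉ e))

  caseZero : Carrier → Carrier → Carrier → Carrier
  caseZero u v y with y ≈? 0#
  ... | yes _ = u
  ... | no  _ = v

  caseZero-≈0 : ∀ {u v y} → y ≈ 0# → caseZero u v y ≈ u
  caseZero-≈0 {y = y} y≈0 with y ≈? 0#
  ... | yes _   = refl
  ... | no  y≉0 = contradiction y≈0 y≉0

  caseZero-≉0 : ∀ {u v y} → y ≉ 0# → caseZero u v y ≈ v
  caseZero-≉0 {y = y} y≉0 with y ≈? 0#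
  ... | yes y≈0 = contradiction y≈0 y≉0
  ... | no  _   = refl

  caseZero-cong : ∀ {u v y z} → y ≈ z → caseZero u v y ≈ caseZero u v z
  caseZero-cong {y = y} {z} y≈z with y ≈? 0# | z ≈? 0#
  ... | yes _   | yes _   = refl
  ... | yes y≈0 | no  z≉0 = contradiction (trans (sym y≈z) y≈0) z≉0
  ... | no  y≉0 | yes z≈0 = contradiction (trans y≈z z≈0) y≉0
  ... | no  _   | no  _   = refl

  zero↦one : Carrier → Carrier
  zero↦one y = caseZero 1# y y

  zero↦one-≉0 : ∀ y → zero↦one y ≉ 0#
  zero↦one-≉0 y with y ≈? 0#
  ... | yes _   = nontrivial
  ... | no  y≉0 = y≉0

  zero↦one-cong : ∀ {y z} → y ≈ z → zero↦one y ≈ zero↦one z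
  zero↦one-cong {y} {z} y≈z with y ≈? 0# | z ≈? 0#
  ... | yes _   | yes _   = refl
  ... | yes y≈0 | no  z≉0 = contradiction (trans (sym y≈z) y≈0) z≉0
  ... | no  y≉0 | yes z≈0 = contradiction (trans y≈z z≈0) y≉0
  ... | no  _   | no  _   = y≈z

  zero↦one-*ˡ : ∀ {x} → x ≉ 0# → ∀ y → zero↦one (x * y) ≈ caseZero 1# x y * zero↦one y
  zero↦one-*ˡ {x} x≉0 y with y ≈? 0#
  ... | yes y≈0 = trans (caseZero-≈0 (trans (*-congˡ y≈0) (zeroʳ x))) (sym (*-identityˡ 1#))
  ... | no  y≉0 = caseZero-≉0 (*-≉0 x≉0 y≉0)

  -- Multiplication by x permutes F and multiplies each nonzero factor of ∏ zero↦one by x.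
  fermat-≉0 : ∀ {x} → x ≉ 0# → x ^ ℕ.pred N ≈ 1#
  fermat-≉0 {x} x≉0 = *-cancelˡ (prod-≉0 _ (zero↦one-≉0 ∘ Card.from)) (begin
    P * x ^ ℕ.pred N                           ≈⟨ *-comm P _ ⟩
    x ^ ℕ.pred N * P                           ≈⟨ *-congʳ ∏-caseZero ⟨
    ∏ (caseZero 1# x) * P                      ≈⟨ prod-distrib-* {N} _ _ ⟨
    ∏ (λ y → caseZero 1# x y * zero↦one y)     ≈⟨ prod-cong-≋ {N} (zero↦one-*ˡ x≉0 ∘ Card.from) ⟨
    ∏ (zero↦one ∘ (x *_))                      ≈⟨ ∏-reindex zero↦one-cong *-congˡ *-congˡ
                                                                x*[x⁻¹*u]≈u x⁻¹*[x*u]≈u ⟨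
    P                                          ≈⟨ *-identityʳ P ⟨
    P * 1#                                     ∎)
    where
    open Invertible x≉0
    P = ∏ zero↦one
    ∏-caseZero : ∏ (caseZero 1# x) ≈ x ^ ℕ.pred N
    ∏-caseZero = ∏-except caseZero-cong 0# (caseZero-≈0 refl) (λ _ → caseZero-≉0)

  fermat : ∀ x → x ^ N ≈ x
  fermat x with x ≈? 0#
  ... | yes x≈0 = begin
    x ^ N                ≈⟨ ^-congʳ x (ℕ.suc-pred N) ⟨
    x * x ^ ℕ.pred N     ≈⟨ *-congʳ x≈0 ⟩
    0# * x ^ ℕ.pred N    ≈⟨ zeroˡ _ ⟩
    0#                   ≈⟨ x≈0 ⟨
    x                    ∎
  ... | no  x≉0 = begin
    x ^ N                ≈⟨ ^-congʳ x (ℕ.suc-pred N) ⟨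
    x * x ^ ℕ.pred N     ≈⟨ *-congˡ (fermat-≉0 x≉0) ⟩
    x * 1#               ≈⟨ *-identityʳ x ⟩
    x                    ∎

  module _ {ℓ′ : Level} {P : Carrier → Set ℓ′} (P? : ∀ x → Dec (P x))
           (P-resp : ∀ {x y} → x ≈ y → P x → P y)
           {f : Carrier → Carrier} (f-closed : ∀ x → P x → P (f x))
           (f-injective : ∀ x y → P x → P y → f x ≈ f y → x ≈ y) where

    -- f on P, extended by the identity off P, transported to Fin N.
    private
      g′ : ∀ i → Dec (P (Card.from i)) → Fin N
      g′ i (yes _) = Card.to (f (Card.from i))
      g′ i (no  _) = i

      g : Fin N → Fin N
      g i = g′ i (P? (Card.from i))

      g′-closed : ∀ i j → P (Card.from i) → Card.to (f (Card.from i)) ≡ j → P (Card.from j)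
      g′-closed i j Pi ≡j = P-resp (trans (sym (Card.strictlyInverseʳ _)) (Card.from-cong ≡j)) (f-closed _ Pi)

      g′-injective : ∀ i j Pi? Pj? → g′ i Pi? ≡ g′ j Pj? → i ≡ j
      g′-injective i j (yes Pi) (yes Pj) gi≡gj = ≡.trans (≡.sym (Card.strictlyInverseˡ i))
        (≡.trans (Card.to-cong (f-injective _ _ Pi Pj (to-injective gi≡gj))) (Card.strictlyInverseˡ j))
      g′-injective i j (yes Pi) (no ¬Pj) gi≡j = contradiction (g′-closed i j Pi gi≡j) ¬Pj
      g′-injective i j (no ¬Pi) (yes Pj) i≡gj = contradiction (g′-closed j i Pj (≡.sym i≡gj)) ¬Pi
      g′-injective i j (no _)   (no _)   i≡j  = i≡j

      preimage : ∀ {y} → P y → ∀ i Pi? → g′ i Pi? ≡ Card.to y → ∃ λ x → P x Product.× f x ≈ y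
      preimage Py i (yes Pi) gi≡y = Card.from i , Pi , to-injective gi≡y
      preimage Py i (no ¬Pi) i≡y  =
        contradiction (P-resp (sym (trans (Card.from-cong i≡y) (Card.strictlyInverseʳ _))) Py) ¬Pi

    injective⇒surjective-on : ∀ y → P y → ∃ λ x → P x Product.× f x ≈ y
    injective⇒surjective-on y Py
      with i , gi≡y ← injective⇒surjective g (λ {i} {j} → g′-injective i j (P? (Card.from i)) (P? (Card.from j))) (Card.to y)
      = preimage Py i (P? (Card.from i)) gi≡y

module TraceKernel {c ℓ : Level} (F : CommutativeRing c ℓ) {N : ℕ} (isFF : IsFiniteFieldOfSize F N)
                   {p : ℕ} (p-prime : Prime p) (r n : ℕ) (N≡qⁿ : N ≡ (p ℕ.^ r) ℕ.^ n) where
  open CommutativeRing F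
  open IsFiniteFieldOfSize isFF using (nontrivial)
  open FiniteField F isFF
  open CharacteristicP F
  open import Algebra.Properties.CommutativeSemiring.Exp commutativeSemiring
    using (_^_; ^-congˡ; ^-congʳ; ^-assocʳ; ^-distrib-*)
  open import Algebra.Properties.Semiring.Mult semiring using (_×_)
  open import Algebra.Properties.CommutativeMonoid.Sum +-commutativeMonoid using (sum; sum-cong-≋; sum-replicate)
  open import Algebra.Properties.Semiring.Sum semiring using (*-distribˡ-sum)
  open import Algebra.Properties.Group +-group using (x∙y⁻¹≈ε⇒x≈y; identityˡ-unique; //-rightDividesˡ)
  open import Relation.Binary.Reasoning.Setoid setoid
  open Exponents using (annihilator-ideal)

  N≡p^[r*n] : N ≡ p ℕ.^ (r ℕ.* n)
  N≡p^[r*n] = ≡.trans N≡qⁿ (ℕ.^-*-assoc p r n)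

  p×1≈0 : p × 1# ≈ 0#
  p×1≈0 = characteristic {p} {r ℕ.* n} N≡p^[r*n]

  open Frobenius p-prime p×1≈0
  open Trace r n

  instance
    q-nonZero : ℕ.NonZero q
    q-nonZero = ℕ.m^n≢0 p r

  module Eigenvector (k : ℕ) {a : Carrier} (a^q≈a : a ^ q ≈ a)
                     {z : Carrier} (z≉0 : z ≉ 0#) (z^pᵏ≈az : z ^ (p ℕ.^ k) ≈ a * z) where
    private
      P = p ℕ.^ k

    a≉0 : a ≉ 0#
    a≉0 a≈0 = z≉0 (^≈0⇒≈0 P (trans z^pᵏ≈az (trans (*-congʳ a≈0) (zeroˡ z))))

    a^[q-1]≈1 : a ^ ℕ.pred q ≈ 1#
    a^[q-1]≈1 = *-cancelˡ a≉0 (trans (^-congʳ a (ℕ.suc-pred q)) (trans a^q≈a (sym (*-identityʳ a))))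

    w : Carrier
    w = z ^ ℕ.pred q

    w≉0 : w ≉ 0#
    w≉0 = ^-≉0 (ℕ.pred q) z≉0

    w^pᵏ≈w : w ^ P ≈ w
    w^pᵏ≈w = begin
      (z ^ ℕ.pred q) ^ P       ≈⟨ ^-comm-^ z (ℕ.pred q) P ⟩
      (z ^ P) ^ ℕ.pred q       ≈⟨ ^-congˡ (ℕ.pred q) z^pᵏ≈az ⟩
      (a * z) ^ ℕ.pred q       ≈⟨ ^-distrib-* a z (ℕ.pred q) ⟩
      a ^ ℕ.pred q * w         ≈⟨ *-congʳ a^[q-1]≈1 ⟩
      1# * w                   ≈⟨ *-identityˡ w ⟩
      w                        ∎

    module _ (gcd[k,n]≡1 : gcd k n ≡ 1) where
      module Fixed = IsAdditiveIdeal (frobenius-fixed-ideal p w)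

      w^p^gcd[k,r]≈w : w ^ (p ℕ.^ gcd k r) ≈ w
      w^p^gcd[k,r]≈w = Fixed.gcd-closed-coprime k r n gcd[k,n]≡1 w^pᵏ≈w
                         (≡.subst (λ m → w ^ m ≈ w) N≡p^[r*n] (fermat w))

      w^q≈w : w ^ q ≈ w
      w^q≈w = Fixed.∣-closed (gcd[m,n]∣n k r) w^p^gcd[k,r]≈w

      z^qⁱ≈z*wⁱ : ∀ i → z ^ (q ℕ.^ i) ≈ z * w ^ i
      z^qⁱ≈z*wⁱ zero    = refl
      z^qⁱ≈z*wⁱ (suc i) = begin
        z ^ (q ℕ.* q ℕ.^ i)              ≈⟨ ^-assocʳ z q (q ℕ.^ i) ⟨
        (z ^ q) ^ (q ℕ.^ i)              ≈⟨ ^-congˡ (q ℕ.^ i) (^-congʳ z (ℕ.suc-pred q)) ⟨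
        (z * w) ^ (q ℕ.^ i)              ≈⟨ ^-distrib-* z w (q ℕ.^ i) ⟩
        z ^ (q ℕ.^ i) * w ^ (q ℕ.^ i)    ≈⟨ *-cong (z^qⁱ≈z*wⁱ i) (^q^i-fixed w^q≈w i) ⟩
        z * w ^ i * w                    ≈⟨ *-assoc z (w ^ i) w ⟩
        z * (w ^ i * w)                  ≈⟨ *-congˡ (*-comm (w ^ i) w) ⟩
        z * w ^ suc i                    ∎

      wⁿ≈1 : w ^ n ≈ 1#
      wⁿ≈1 = *-cancelˡ z≉0 (begin
        z * w ^ n          ≈⟨ z^qⁱ≈z*wⁱ n ⟨
        z ^ (q ℕ.^ n)      ≈⟨ ≡.subst (λ m → z ^ m ≈ z) N≡qⁿ (fermat z) ⟩
        z                  ≈⟨ *-identityʳ z ⟨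
        z * 1#             ∎)

      w^[pᵈ-1]≈1 : w ^ ℕ.pred (p ℕ.^ gcd k r) ≈ 1#
      w^[pᵈ-1]≈1 = *-cancelˡ w≉0 (begin
        w * w ^ ℕ.pred (p ℕ.^ gcd k r) ≈⟨ ^-congʳ w (ℕ.suc-pred (p ℕ.^ gcd k r) {{ℕ.m^n≢0 p (gcd k r)}}) ⟩
        w ^ (p ℕ.^ gcd k r)            ≈⟨ w^p^gcd[k,r]≈w ⟩
        w                              ≈⟨ *-identityʳ w ⟨
        w * 1#                         ∎)

      module _ (gcd[n,pᵈ-1]≡1 : gcd n (p ℕ.^ gcd k r ℕ.∸ 1) ≡ 1) where
        module Period = IsAdditiveIdeal (annihilator-ideal *-monoid w)

        w≈1 : w ≈ 1#
        w≈1 = trans (sym (*-identityʳ w)) (Period.coprime-closed n _ gcd[n,pᵈ-1]≡1 wⁿ≈1 w^[pᵈ-1]≈1)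

        module _ (Trz≈0 : Tr z ≈ 0#) where

          n×1≈0 : n × 1# ≈ 0#
          n×1≈0 = *-cancelˡ z≉0 (begin
            z * n × 1#                       ≈⟨ *-congˡ (sum-replicate n) ⟨
            z * sum {n} (λ _ → 1#)           ≈⟨ *-congˡ (sum-cong-≋ {n} (wⁱ≈1 ∘ toℕ)) ⟨
            z * sum {n} (λ i → w ^ toℕ i)    ≈⟨ *-distribˡ-sum {n} z _ ⟩
            sum {n} (λ i → z * w ^ toℕ i)    ≈⟨ sum-cong-≋ {n} (z^qⁱ≈z*wⁱ ∘ toℕ) ⟨
            Tr z                             ≈⟨ Trz≈0 ⟩
            0#                               ≈⟨ zeroʳ z ⟨
            z * 0#                           ∎)
            where
            wⁱ≈1 : ∀ i → w ^ i ≈ 1#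
            wⁱ≈1 i = Period.∣-closed (1∣ i) (trans (*-identityʳ w) w≈1)

  eigenvector-trace-≉0 : ∀ k {a} → a ^ q ≈ a →
                         gcd k n ≡ 1 → gcd n (p ℕ.^ gcd k r ℕ.∸ 1) ≡ 1 → ¬ p ∣ n →
                         ∀ {z} → z ≉ 0# → z ^ (p ℕ.^ k) ≈ a * z → Tr z ≉ 0#
  eigenvector-trace-≉0 k a^q≈a gcd[k,n]≡1 gcd[n,pᵈ-1]≡1 p∤n z≉0 z^pᵏ≈az Trz≈0 =
    nontrivial (trans (sym (+-identityʳ 1#)) (Char.coprime-closed n p (prime∤⇒gcd≡1 p-prime p∤n)
                                                (n×1≈0 gcd[k,n]≡1 gcd[n,pᵈ-1]≡1 Trz≈0) p×1≈0))
    where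
    open Eigenvector k a^q≈a z≉0 z^pᵏ≈az
    module Char = IsAdditiveIdeal (annihilator-ideal +-monoid 1#)

  linPoly-permutes-ker : ∀ k {a} → a ^ q ≈ a →
                         gcd k n ≡ 1 → gcd n (p ℕ.^ gcd k r ℕ.∸ 1) ≡ 1 → ¬ p ∣ n →
                         PermutesKer F q n (linPoly F p k a)
  linPoly-permutes-ker k a^q≈a gcd[k,n]≡1 gcd[n,pᵈ-1]≡1 p∤n =
    f-ker , f-injective , injective⇒surjective-on (λ x → Tr x ≈? 0#) ker-resp f-ker f-injective
    where
    open Linearized k a^q≈a

    ker-resp : ∀ {x y} → x ≈ y → Ker x → Ker y
    ker-resp x≈y = trans (trace-cong (sym x≈y))

    f-kernel-trivial : ∀ z → Ker z → f z ≈ 0# → z ≈ 0#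
    f-kernel-trivial z Trz≈0 fz≈0 with z ≈? 0#
    ... | yes z≈0 = z≈0
    ... | no  z≉0 = contradiction Trz≈0
      (eigenvector-trace-≉0 k a^q≈a gcd[k,n]≡1 gcd[n,pᵈ-1]≡1 p∤n z≉0 (x∙y⁻¹≈ε⇒x≈y _ _ fz≈0))

    f-injective : ∀ x y → Ker x → Ker y → f x ≈ f y → x ≈ y
    f-injective x y Trx≈0 Try≈0 fx≈fy =
      x∙y⁻¹≈ε⇒x≈y x y (f-kernel-trivial (x - y) (ker-sub Trx≈0 Try≈0) f[x-y]≈0)
      where
      f[x-y]≈0 : f (x - y) ≈ 0#
      f[x-y]≈0 = identityˡ-unique (f (x - y)) (f y) (begin
        f (x - y) + f y     ≈⟨ f-homo-+ (x - y) y ⟨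
        f (x - y + y)       ≈⟨ f-cong (//-rightDividesˡ y x) ⟩
        f x                 ≈⟨ fx≈fy ⟩
        f y                 ∎)

open import Data.Nat using (_^_; _∸_; _≥_)

corollary3 : ∀ {c ℓ : Level} (p r n k : ℕ) → Prime p → r ≥ 1 → n ≥ 1 → k ≥ 1
    → gcd k n ≡ 1 → ¬ (p ∣ n) → gcd n (p ^ gcd k r ∸ 1) ≡ 1
    → (F : CommutativeRing c ℓ) → IsFiniteFieldOfSize F ((p ^ r) ^ n)
    → (a : CommutativeRing.Carrier F) → InSubfield F (p ^ r) a
    → PermutesKer F (p ^ r) n (linPoly F p k a)
corollary3 p r n k p-prime _ _ _ gcd[k,n]≡1 p∤n gcd[n,pᵈ-1]≡1 F isFF a a^q≈a =
  linPoly-permutes-ker k a^q≈a gcd[k,n]≡1 gcd[n,pᵈ-1]≡1 p∤n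
  where open TraceKernel F isFF p-prime r n ≡.refl
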